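{- If two patterns $P$ and $Q$ are in the same solitaire orbit (i.e. $Q\in\gamma(P)$), then $\varphi(P)=\varphi(Q)$.
   Context: A pattern is a finite subset $P\subset\mathbb{Z}^2$. Let $T=\{(0,1),(1,1),(1,0)\}$. A solitaire move applies to $P$ at $v\in\mathbb{Z}^2$ when $|P\cap(v+T)|=2$, and replaces $P$ by $(P\setminus(v+T))\cup S$ for an arbitrary two-element subset $S\subset v+T$; $\gamma(P)$ is the set of patterns reachable from $P$ by finitely many such moves. The filling $\varphi(P)$ is obtained from $P$ by repeatedly adding a point $w$ whenever there is $v\in\mathbb{Z}^2$ with $|P\cap(v+T)|=2$ (for the current set $P$) and $w\in v+T$, until no more points can be added; equivalently, $\varphi(P)$ is the smallest set containing $P$ such that every translate $v+T$ meeting it in at least two points is contained in it. -}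

module Defs where

open import Data.Integer using (ℤ; _+_; +_)
open import Data.Product using (_×_; _,_; Σ; ∃)
open import Data.Sum using (_⊎_)
open import Data.Fin using (Fin; zero; suc)
open import Data.List using (List)
open import Data.List.Membership.Propositional using (_∈_; _∉_)
open import Relation.Binary.PropositionalEquality using (_≡_; _≢_)
open import Relation.Binary.Construct.Closure.ReflexiveTransitive using (Star)
open import Function.Bundles using (_⇔_)
open import Relation.Nullary using (¬_)

Point : Set
Point = ℤ × ℤ

-- A pattern: a finite subset of ℤ², represented by a list of points
-- (considered as the set of its elements; order/multiplicity irrelevant).
Pattern : Set
Pattern = List Point

tElem : Fin 3 → Point
tElem zero = (+ 0 , + 1)
tElem (suc zero) = (+ 1 , + 1)
tElem (suc (suc zero)) = (+ 1 , + 0)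

pt : Point → Fin 3 → Point
pt (a , b) k with tElem k
... | (c , d) = (a + c , b + d)

InTri : Point → Point → Set
InTri v w = ∃ λ k → w ≡ pt v k

-- |P ∩ (v+T)| = 2 : exactly one of the three (distinct) points of v+T
-- is missing from P.
Two : Pattern → Point → Set
Two P v = ∃ λ k → (pt v k ∉ P) × (∀ j → j ≢ k → pt v j ∈ P)

-- One solitaire move at v: P meets v+T in two points, and Q equals
-- (P ∖ (v+T)) ∪ S with S = (v+T) ∖ {pt v k'} an arbitrary 2-element subset.
MoveAt : Point → Pattern → Pattern → Set
MoveAt v P Q = Two P v × ∃ λ k' →
  ∀ w → (w ∈ Q) ⇔ (((w ∈ P) × ¬ InTri v w) ⊎ (InTri v w × w ≢ pt v k'))

Move : Pattern → Pattern → Set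
Move P Q = ∃ λ v → MoveAt v P Q

_∈γ_ : Pattern → Pattern → Set
Q ∈γ P = Star Move P Q

-- The filling φ(P), as the least set containing P closed under:
-- if two (distinct) points of v+T lie in it, all of v+T lies in it.
data φ (P : Pattern) : Point → Set where
  base : ∀ {w} → w ∈ P → φ P w
  fill : ∀ v i j k → i ≢ j → φ P (pt v i) → φ P (pt v j) → φ P (pt v k)

{-# OPTIONS --safe #-}
-- A move at v changes P only inside v + T, and both before and after the move
-- two of the three points of v + T are present.  Hence each side of a move lies
-- in the filling of the other, and as φ is the least closed superset, the two
-- fillings coincide.
module Submission where

open import Defs
open import Data.Integer using (_+_; +_) renaming (suc to sucℤ)
open import Data.Integer.Properties using (_≟_; +-comm; +-identityʳ; i≢suc[i])
open import Data.Fin using (Fin; zero; suc)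
open import Data.Fin.Properties using (any?)
open import Data.Product using (_,_; proj₁; proj₂)
open import Data.Product.Properties using (≡-dec)
open import Data.Sum using (inj₁; inj₂)
open import Data.Empty using (⊥-elim)
open import Data.List.Membership.Propositional using (_∈_)
open import Function.Base using (_∘_)
open import Function.Bundles using (_⇔_; mk⇔; Equivalence)
open import Function.Definitions using (Injective)
open import Function.Construct.Identity using (⇔-id)
open import Function.Construct.Composition using (_⇔-∘_)
open import Relation.Binary.Definitions using (DecidableEquality)
open import Relation.Binary.PropositionalEquality using (_≡_; _≢_; refl; sym; cong; module ≡-Reasoning)
open import Relation.Binary.Construct.Closure.ReflexiveTransitive using (ε; _◅_)
open import Relation.Nullary using (Dec; yes; no)
open import Relation.Unary using (_⊆_)

i+0≢i+1 : ∀ i → i + + 0 ≢ i + + 1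
i+0≢i+1 i eq = i≢suc[i] (begin
  i         ≡⟨ sym (+-identityʳ i) ⟩
  i + + 0   ≡⟨ eq ⟩
  i + + 1   ≡⟨ +-comm i (+ 1) ⟩
  sucℤ i    ∎)
  where open ≡-Reasoning

i+1≢i+0 : ∀ i → i + + 1 ≢ i + + 0
i+1≢i+0 i eq = i+0≢i+1 i (sym eq)

pt-injective : ∀ v → Injective _≡_ _≡_ (pt v)
pt-injective (a , b) {zero}             {zero}             _  = refl
pt-injective (a , b) {zero}             {suc zero}         eq = ⊥-elim (i+0≢i+1 a (cong proj₁ eq))
pt-injective (a , b) {zero}             {suc (suc zero)}   eq = ⊥-elim (i+0≢i+1 a (cong proj₁ eq))
pt-injective (a , b) {suc zero}         {zero}             eq = ⊥-elim (i+1≢i+0 a (cong proj₁ eq))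
pt-injective (a , b) {suc zero}         {suc zero}         _  = refl
pt-injective (a , b) {suc zero}         {suc (suc zero)}   eq = ⊥-elim (i+1≢i+0 b (cong proj₂ eq))
pt-injective (a , b) {suc (suc zero)}   {zero}             eq = ⊥-elim (i+1≢i+0 a (cong proj₁ eq))
pt-injective (a , b) {suc (suc zero)}   {suc zero}         eq = ⊥-elim (i+0≢i+1 b (cong proj₂ eq))
pt-injective (a , b) {suc (suc zero)}   {suc (suc zero)}   _  = refl

_≟ₚ_ : DecidableEquality Point
_≟ₚ_ = ≡-dec _≟_ _≟_

InTri? : ∀ v w → Dec (InTri v w)
InTri? v w = any? (λ k → w ≟ₚ pt v k)

record OtherTwo (k : Fin 3) : Set where
  field
    i j : Fin 3
    i≢j : i ≢ j
    i≢k : i ≢ k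
    j≢k : j ≢ k

otherTwo : ∀ k → OtherTwo k
otherTwo zero             = record { i = suc zero ; j = suc (suc zero) ; i≢j = λ () ; i≢k = λ () ; j≢k = λ () }
otherTwo (suc zero)       = record { i = zero ; j = suc (suc zero) ; i≢j = λ () ; i≢k = λ () ; j≢k = λ () }
otherTwo (suc (suc zero)) = record { i = zero ; j = suc zero ; i≢j = λ () ; i≢k = λ () ; j≢k = λ () }

φ-fill-tri : ∀ {R} v k → (∀ j → j ≢ k → φ R (pt v j)) → ∀ m → φ R (pt v m)
φ-fill-tri v k others m = fill v i j m i≢j (others i i≢k) (others j j≢k)
  where open OtherTwo (otherTwo k)

φ-least : ∀ {P Q} → (_∈ P) ⊆ φ Q → φ P ⊆ φ Q
φ-least P⊆φQ (base w∈P)            = P⊆φQ w∈P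
φ-least P⊆φQ (fill v i j k i≢j x y) = fill v i j k i≢j (φ-least P⊆φQ x) (φ-least P⊆φQ y)

move-source⊆φ-target : ∀ {P Q} → Move P Q → (_∈ P) ⊆ φ Q
move-source⊆φ-target {Q = Q} (v , _ , k′ , Q≡) {w} w∈P with InTri? v w
... | yes (m , refl) = φ-fill-tri v k′ kept m
  where
  kept : ∀ j → j ≢ k′ → φ Q (pt v j)
  kept j j≢k′ = base (Equivalence.from (Q≡ (pt v j)) (inj₂ ((j , refl) , j≢k′ ∘ pt-injective v)))
... | no w∉vT = base (Equivalence.from (Q≡ w) (inj₁ (w∈P , w∉vT)))

move-target⊆φ-source : ∀ {P Q} → Move P Q → (_∈ Q) ⊆ φ P
move-target⊆φ-source (v , (k , _ , present) , _ , Q≡) {w} w∈Q with Equivalence.to (Q≡ w) w∈Q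
... | inj₁ (w∈P , _)       = base w∈P
... | inj₂ ((m , refl) , _) = φ-fill-tri v k (λ j j≢k → base (present j j≢k)) m

move-preserves-φ : ∀ {P Q} → Move P Q → ∀ w → φ P w ⇔ φ Q w
move-preserves-φ move w =
  mk⇔ (φ-least (move-source⊆φ-target move)) (φ-least (move-target⊆φ-source move))

lemma1 : (P Q : Pattern) → Q ∈γ P → ∀ w → φ P w ⇔ φ Q w
lemma1 P .P ε w = ⇔-id _
lemma1 P Q (move ◅ moves) w = lemma1 _ Q moves w ⇔-∘ move-preserves-φ move w
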